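{- Let $G$ and $H$ be connected graphs, each with at least two vertices. Then $q(G\square H)>\frac12$.
   Context: All graphs are finite, simple and undirected. For a vertex $v$, $d(v)$ is its degree, $N[v]$ its closed neighbourhood and $d[v]=d(v)+1$. A partition of a graph $G$ is a pair $(V_1,V_2)$ of nonempty disjoint sets with union $V(G)$; for $v\in V_i$, $q^i(v)=|N[v]\cap V_i|/d[v]$, and $q(G)=\max_{(V_1,V_2)}\min\{q^i(v): i\in\{1,2\}, v\in V_i\}$ over all partitions. The cartesian product $G\square H$ has vertex set $V(G)\times V(H)$, with $(g_1,h_1)$ adjacent to $(g_2,h_2)$ iff either $g_1=g_2$ and $h_1h_2\in E(H)$, or $h_1=h_2$ and $g_1g_2\in E(G)$. -}

module Defs where

open import Data.Bool using (Bool; true; false; _∧_; _∨_; if_then_else_; not)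
open import Data.Nat using (ℕ; zero; suc; _+_; _*_; _≤_)
open import Data.Integer using (+_)
open import Data.Fin using (Fin; _≟_; remQuot)
open import Data.List using (List; []; _∷_; map; foldr; concatMap)
open import Data.Nat.ListAction using (sum)
open import Data.Bool.ListAction using (any)
open import Data.List.Base using (allFin)
open import Data.Vec using (Vec; []; _∷_; lookup; toList)
open import Data.Product using (_×_; _,_; ∃)
open import Data.Rational using (ℚ; _/_; _⊔_; _⊓_; 0ℚ; 1ℚ)
open import Relation.Nullary.Decidable using (isYes; yes; no)
open import Relation.Binary.PropositionalEquality using (_≡_; refl; sym; cong₂)

_==_ : ∀ {n} → Fin n → Fin n → Bool
a == b = isYes (a ≟ b)

==-refl : ∀ {n} (a : Fin n) → (a == a) ≡ true
==-refl a with a ≟ a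
... | yes _ = refl
... | no ¬p = Data.Empty.⊥-elim (¬p refl)
  where import Data.Empty

==-sym : ∀ {n} (a b : Fin n) → (a == b) ≡ (b == a)
==-sym a b with a ≟ b | b ≟ a
... | yes _ | yes _ = refl
... | no _  | no _  = refl
... | yes p | no ¬q = Data.Empty.⊥-elim (¬q (sym p))
  where import Data.Empty
... | no ¬p | yes q = Data.Empty.⊥-elim (¬p (sym q))
  where import Data.Empty

record Graph : Set where
  field
    n      : ℕ
    adj    : Fin n → Fin n → Bool
    adj-sym : ∀ u v → adj u v ≡ adj v u
    irrefl : ∀ v → adj v v ≡ false
open Graph public

data Walk (G : Graph) : Fin (n G) → Fin (n G) → Set where
  here : ∀ {u} → Walk G u u
  step : ∀ {u w v} → adj G u w ≡ true → Walk G w v → Walk G u v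

Connected : Graph → Set
Connected G = ∀ u v → Walk G u v

χ : Bool → ℕ
χ true  = 1
χ false = 0

deg : (G : Graph) → Fin (n G) → ℕ
deg G v = sum (map (λ w → χ (adj G v w)) (allFin (n G)))

inN[_] : (G : Graph) → Fin (n G) → Fin (n G) → Bool
inN[ G ] v w = (w == v) ∨ adj G v w

private
  ∨-comm : ∀ a b → (a ∨ b) ≡ (b ∨ a)
  ∨-comm false false = refl
  ∨-comm false true  = refl
  ∨-comm true  false = refl
  ∨-comm true  true  = refl

  prodAdj : (G H : Graph) → Fin (n G) × Fin (n H) → Fin (n G) × Fin (n H) → Bool
  prodAdj G H (g₁ , h₁) (g₂ , h₂) = ((g₁ == g₂) ∧ adj H h₁ h₂) ∨ ((h₁ == h₂) ∧ adj G g₁ g₂)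

  prodAdj-sym : ∀ G H p q → prodAdj G H p q ≡ prodAdj G H q p
  prodAdj-sym G H (g₁ , h₁) (g₂ , h₂)
    rewrite ==-sym g₁ g₂ | ==-sym h₁ h₂ | adj-sym H h₁ h₂ | adj-sym G g₁ g₂ = refl

  prodAdj-irr : ∀ G H p → prodAdj G H p p ≡ false
  prodAdj-irr G H (g , h) rewrite ==-refl g | ==-refl h | irrefl G g | irrefl H h = refl

_□_ : Graph → Graph → Graph
G □ H = record
  { n      = n G * n H
  ; adj    = λ i j → prodAdj G H (remQuot (n H) i) (remQuot (n H) j)
  ; adj-sym = λ i j → prodAdj-sym G H (remQuot (n H) i) (remQuot (n H) j)
  ; irrefl = λ i → prodAdj-irr G H (remQuot (n H) i)
  }

-- A 2-colouring of the vertices: vertex v lies in V₁ iff lookup s v ≡ true.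
-- It is a partition (V₁, V₂) iff both sides are nonempty.
isPartition : ∀ {k} → Vec Bool k → Bool
isPartition s = any (λ b → b) (toList s) ∧ any not (toList s)

sameSideClosed : (G : Graph) → Vec Bool (n G) → Fin (n G) → ℕ
sameSideClosed G s v =
  sum (map (λ w → χ (inN[ G ] v w ∧ isYes (lookup s w Data.Bool.≟ lookup s v))) (allFin (n G)))
  where import Data.Bool

qv : (G : Graph) → Vec Bool (n G) → Fin (n G) → ℚ
qv G s v = + sameSideClosed G s v / suc (deg G v)

-- min over all vertices (values lie in [0,1], so the default 1 is neutral on nonempty lists)
qPart : (G : Graph) → Vec Bool (n G) → ℚ
qPart G s = foldr _⊓_ 1ℚ (map (qv G s) (allFin (n G)))

allVecs : ∀ k → List (Vec Bool k)
allVecs zero    = [] ∷ []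
allVecs (suc k) = concatMap (λ v → (true ∷ v) ∷ (false ∷ v) ∷ []) (allVecs k)

-- q(G) = max over partitions of the min over vertices
-- (values lie in [0,1], so the default 0 is neutral when a partition exists, i.e. n G ≥ 2)
q : Graph → ℚ
q G = foldr _⊔_ 0ℚ (map (qPart G) (Data.List.filterᵇ isPartition (allVecs (n G))))
  where import Data.List

-- Choose a vertex u of minimum degree in G and w of minimum degree in H, and assume
-- d(u) ≤ d(w) (otherwise swap the factors). Put the H-fibre {u} × V(H) on one side.
-- A vertex (g,h) keeps all d(h) ≥ d(u) of its H-neighbours on its own side, while its
-- neighbours on the other side are of the form (g',h) with g' ~ g and exactly one of
-- g, g' equal to u; there are at most d(u) of them. Hence every vertex has at least as
-- many neighbours on its side as across, so together with itself it has strictly more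
-- than half of its closed neighbourhood on its side.
module Submission where

open import Defs
open import Data.Nat using (_≤_)
open import Data.Rational using (½; _<_)

import Data.Nat.Properties as ℕP
open import Algebra.Properties.CommutativeMonoid.Sum ℕP.+-0-commutativeMonoid
  using (sum-syntax; sum-cong-≗; sum-replicate-zero; ∑-distrib-+; ∑-comm)
  renaming (sum to ∑)
open import Data.Bool as Bool using (Bool; true; false; _∧_; _∨_; not; T)
open import Data.Bool.Properties using (∧-assoc; ∧-identityʳ; ∧-zeroʳ; ∨-comm; T-∧; T-≡)
open import Data.Fin as Fin using (Fin; zero; suc; _↑ˡ_; _↑ʳ_; combine; remQuot)
open import Data.Fin.Properties using (remQuot-combine; suc-injective)
open import Data.List using ([]; _∷_; map; tabulate; allFin; concatMap)
open import Data.List.Extrema.Nat using (argmin; f[argmin]≤f[xs])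
open import Data.List.Membership.Propositional using (_∈_; lose)
open import Data.List.Membership.Propositional.Properties
  using (∈-allFin; ∈-filter⁺; ∈-map⁺; ∈-concatMap⁺)
open import Data.List.Properties using (foldr-preservesᵇ; foldr-preservesᵒ)
open import Data.List.Relation.Unary.All as All using (All)
open import Data.List.Relation.Unary.All.Properties using (map⁺; tabulate⁺)
open import Data.List.Relation.Unary.Any using (here; there)
open import Data.List.Relation.Unary.Any.Properties using (any⁺)
open import Data.Nat as ℕ using (ℕ; zero; suc; _+_; _*_; z≤n; s≤s)
import Data.Nat.ListAction as ListAction
open import Data.Product using (_×_; _,_; proj₁; proj₂; swap; uncurry; ∃-syntax)
open import Data.Sum using (_⊎_; inj₁; inj₂; [_,_]′)
open import Data.Vec as Vec using (Vec; lookup)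
open import Data.Vec.Properties using (lookup∘tabulate)
open import Data.Vec.Membership.Propositional.Properties using (∈-lookup; ∈-toList⁺)
import Data.Integer as ℤ
import Data.Integer.Properties as ℤP
open import Data.Rational using (_/_; _⊓_; _⊔_; 0ℚ; 1ℚ)
import Data.Rational.Properties as ℚP
import Data.Rational.Unnormalised as ℚᵘ
import Data.Rational.Unnormalised.Properties as ℚᵘP
open import Function using (_∘_; Equivalence)
open import Relation.Nullary using (Dec; yes; no; contradiction)
open import Relation.Nullary.Decidable using (isYes; toWitness; T?)
open import Relation.Binary.PropositionalEquality

∑-mono-≤ : ∀ {k} {f g : Fin k → ℕ} → (∀ i → f i ≤ g i) → ∑ f ≤ ∑ g
∑-mono-≤ {zero}  f≤g = z≤n
∑-mono-≤ {suc k} f≤g = ℕP.+-mono-≤ (f≤g zero) (∑-mono-≤ (f≤g ∘ suc))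

term≤∑ : ∀ {k} (f : Fin k → ℕ) i → f i ≤ ∑ f
term≤∑ f zero    = ℕP.m≤m+n (f zero) _
term≤∑ f (suc i) = ℕP.≤-trans (term≤∑ (f ∘ suc) i) (ℕP.m≤n+m _ (f zero))

∑-zero : ∀ {k} (f : Fin k → ℕ) → (∀ i → f i ≡ 0) → ∑ f ≡ 0
∑-zero {k} f f≡0 = trans (sum-cong-≗ f≡0) (sum-replicate-zero k)

∑-single : ∀ {k} (f : Fin k → ℕ) i → (∀ j → j ≢ i → f j ≡ 0) → ∑ f ≡ f i
∑-single f zero f≡0 =
  trans (cong (f zero +_) (∑-zero (f ∘ suc) (λ j → f≡0 (suc j) λ ()))) (ℕP.+-identityʳ _)
∑-single f (suc i) f≡0 =
  cong₂ _+_ (f≡0 zero λ ()) (∑-single (f ∘ suc) i λ j j≢i → f≡0 (suc j) (j≢i ∘ suc-injective))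

∑-↑ : ∀ a {b} (f : Fin (a + b) → ℕ) → ∑ f ≡ ∑ (f ∘ (_↑ˡ b)) + ∑ (f ∘ (a ↑ʳ_))
∑-↑ zero    f = refl
∑-↑ (suc a) f = trans (cong (f zero +_) (∑-↑ a (f ∘ suc))) (sym (ℕP.+-assoc (f zero) _ _))

∑-combine : ∀ m {n} (f : Fin (m * n) → ℕ) → ∑ f ≡ ∑[ i < m ] ∑[ j < n ] f (combine i j)
∑-combine zero        f = refl
∑-combine (suc m) {n} f =
  trans (∑-↑ n f) (cong (∑ (f ∘ (_↑ˡ m * n)) +_) (∑-combine m (f ∘ (n ↑ʳ_))))

∑-remQuot : ∀ m n (f : Fin m × Fin n → ℕ) →
            ∑ (f ∘ remQuot {m} n) ≡ ∑[ i < m ] ∑[ j < n ] f (i , j)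
∑-remQuot m n f = trans (∑-combine m (f ∘ remQuot n))
  (sum-cong-≗ λ i → sum-cong-≗ λ j → cong f (remQuot-combine i j))

sum-map-tabulate : ∀ {a} {A : Set a} {k} (f : A → ℕ) (g : Fin k → A) →
                   ListAction.sum (map f (tabulate g)) ≡ ∑ (f ∘ g)
sum-map-tabulate {k = zero}  f g = refl
sum-map-tabulate {k = suc k} f g = cong (f (g zero) +_) (sum-map-tabulate f (g ∘ suc))

χ-∧≤ : ∀ a b → χ (a ∧ b) ≤ χ a
χ-∧≤ true  true  = ℕP.≤-refl
χ-∧≤ true  false = z≤n
χ-∧≤ false b     = z≤n

χ-∨≥ : ∀ a b → χ a ≤ χ (a ∨ b)
χ-∨≥ true  b     = ℕP.≤-refl
χ-∨≥ false b     = z≤n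

χ-split : ∀ a b → χ a ≡ χ (a ∧ b) + χ (a ∧ not b)
χ-split true  true  = refl
χ-split true  false = refl
χ-split false b     = refl

same : Bool → Bool → Bool
same a b = isYes (a Bool.≟ b)

same-refl : ∀ a → same a a ≡ true
same-refl true  = refl
same-refl false = refl

==-≢ : ∀ {k} {i j : Fin k} → i ≢ j → (i == j) ≡ false
==-≢ {i = i} {j} i≢j with i Fin.≟ j
... | yes i≡j = contradiction i≡j i≢j
... | no  _   = refl

∑-indicator : ∀ {k} (i : Fin k) b → ∑[ j < k ] χ ((i == j) ∧ b) ≡ χ b
∑-indicator i b =
  trans (∑-single _ i λ j j≢i → cong (λ x → χ (x ∧ b)) (==-≢ (j≢i ∘ sym)))
        (cong (λ x → χ (x ∧ b)) (==-refl i))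

another : ∀ {k} → 2 ≤ k → (i : Fin k) → ∃[ j ] j ≢ i
another (s≤s (s≤s _)) zero    = suc zero , λ ()
another (s≤s (s≤s _)) (suc _) = zero , λ ()

argmin-Fin : ∀ {k} (f : Fin k → ℕ) → Fin k → ∃[ i ] (∀ j → f i ≤ f j)
argmin-Fin f i₀ =
  argmin f i₀ (allFin _) , λ j → All.lookup (f[argmin]≤f[xs] i₀ (allFin _)) (∈-allFin j)

½<a/d : ∀ a d .{{_ : ℕ.NonZero d}} → d ℕ.< 2 * a → ½ < ℤ.+ a / d
½<a/d a (suc d) d<2a = ℚP.toℚᵘ-cancel-<
  (ℚᵘP.<-respʳ-≃ (ℚᵘP.≃-sym (ℚP.toℚᵘ-fromℚᵘ (ℚᵘ.mkℚᵘ (ℤ.+ a) d))) (ℚᵘ.*<* cross-multiplied))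
  where
  cross-multiplied : ℤ.+ 1 ℤ.* ℤ.+ suc d ℤ.< ℤ.+ a ℤ.* ℤ.+ 2
  cross-multiplied = subst₂ ℤ._<_ (ℤP.pos-* 1 (suc d)) (ℤP.pos-* a 2)
    (ℤ.+<+ (subst₂ ℕ._<_ (sym (ℕP.*-identityˡ (suc d))) (ℕP.*-comm 2 a) d<2a))

½<1 : ½ < 1ℚ
½<1 = toWitness {a? = ½ ℚP.<? 1ℚ} _

deg≡∑ : ∀ G v → deg G v ≡ ∑[ w < n G ] χ (adj G v w)
deg≡∑ G v = sum-map-tabulate (λ w → χ (adj G v w)) (λ w → w)

sameDeg crossDeg : (G : Graph) → (Fin (n G) → Bool) → Fin (n G) → ℕ
sameDeg  G c v = ∑[ w < n G ] χ (adj G v w ∧ same (c w) (c v))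
crossDeg G c v = ∑[ w < n G ] χ (adj G v w ∧ not (same (c w) (c v)))

deg≡sameDeg+crossDeg : ∀ G c v → deg G v ≡ sameDeg G c v + crossDeg G c v
deg≡sameDeg+crossDeg G c v =
  trans (deg≡∑ G v) (trans (sum-cong-≗ (λ w → χ-split (adj G v w) (same (c w) (c v))))
    (∑-distrib-+ (λ w → χ (adj G v w ∧ same (c w) (c v))) (λ w → χ (adj G v w ∧ not (same (c w) (c v))))))

sameSideClosed≡1+sameDeg : ∀ G s v → sameSideClosed G s v ≡ suc (sameDeg G (lookup s) v)
sameSideClosed≡1+sameDeg G s v = begin
  sameSideClosed G s v
    ≡⟨ sum-map-tabulate (λ w → χ (inN[ G ] v w ∧ same (lookup s w) (lookup s v))) (λ w → w) ⟩
  ∑[ w < n G ] χ (inN[ G ] v w ∧ same (lookup s w) (lookup s v))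
    ≡⟨ sum-cong-≗ closed-split ⟩
  ∑[ w < n G ] (χ (w == v) + χ (adj G v w ∧ same (lookup s w) (lookup s v)))
    ≡⟨ ∑-distrib-+ (λ w → χ (w == v)) (λ w → χ (adj G v w ∧ same (lookup s w) (lookup s v))) ⟩
  ∑[ w < n G ] χ (w == v) + sameDeg G (lookup s) v
    ≡⟨ cong (_+ sameDeg G (lookup s) v) ∑χ[w==v]≡1 ⟩
  suc (sameDeg G (lookup s) v) ∎
  where
  open ≡-Reasoning
  closed-split : ∀ w → χ (inN[ G ] v w ∧ same (lookup s w) (lookup s v))
                     ≡ χ (w == v) + χ (adj G v w ∧ same (lookup s w) (lookup s v))
  closed-split w with w Fin.≟ v
  ... | yes refl rewrite same-refl (lookup s w) | irrefl G w = refl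
  ... | no  _    = refl
  ∑χ[w==v]≡1 : ∑[ w < n G ] χ (w == v) ≡ 1
  ∑χ[w==v]≡1 = trans (∑-single _ v λ w w≢v → cong χ (==-≢ w≢v)) (cong χ (==-refl v))

½<qv : ∀ G s v → crossDeg G (lookup s) v ≤ sameDeg G (lookup s) v → ½ < qv G s v
½<qv G s v cross≤same = subst₂ (λ a d → ½ < ℤ.+ a / suc d)
  (sym (sameSideClosed≡1+sameDeg G s v)) (sym (deg≡sameDeg+crossDeg G (lookup s) v))
  (½<a/d (suc X) (suc (X + Y)) 1+X+Y<2[1+X])
  where
  X Y : ℕ
  X = sameDeg G (lookup s) v
  Y = crossDeg G (lookup s) v
  1+X+Y<2[1+X] : suc (X + Y) ℕ.< 2 * suc X
  1+X+Y<2[1+X] = begin-strict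
    suc (X + Y)     ≤⟨ s≤s (ℕP.+-monoʳ-≤ X cross≤same) ⟩
    suc (X + X)     <⟨ s≤s (ℕP.+-monoʳ-< X (ℕP.n<1+n X)) ⟩
    suc (X + suc X) ≡⟨ cong (suc X +_) (ℕP.+-identityʳ (suc X)) ⟨
    2 * suc X       ∎
    where open ℕP.≤-Reasoning

isPartition-intro : ∀ {k} (s : Vec Bool k) i j → lookup s i ≡ true → lookup s j ≡ false →
                    T (isPartition s)
isPartition-intro s i j sᵢ sⱼ = Equivalence.from T-∧
  ( any⁺ (λ b → b) (lose (∈-toList⁺ (∈-lookup i s)) (Equivalence.from T-≡ sᵢ))
  , any⁺ not (lose (∈-toList⁺ (∈-lookup j s)) (Equivalence.from T-≡ (cong not sⱼ))) )

allVecs-complete : ∀ k (s : Vec Bool k) → s ∈ allVecs k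
allVecs-complete zero    Vec.[]      = here refl
allVecs-complete (suc k) (b Vec.∷ s) =
  ∈-concatMap⁺ (λ v → (true Vec.∷ v) ∷ (false Vec.∷ v) ∷ []) (lose (allVecs-complete k s) (extend b))
  where
  extend : ∀ b → (b Vec.∷ s) ∈ (true Vec.∷ s) ∷ (false Vec.∷ s) ∷ []
  extend true  = here refl
  extend false = there (here refl)

½<⊓ : ∀ {p r} → ½ < p → ½ < r → ½ < p ⊓ r
½<⊓ {p} {r} ½<p ½<r with ℚP.⊓-sel p r
... | inj₁ p⊓r≡p = subst (½ <_) (sym p⊓r≡p) ½<p
... | inj₂ p⊓r≡r = subst (½ <_) (sym p⊓r≡r) ½<r

½<⊔ : ∀ p r → ½ < p ⊎ ½ < r → ½ < p ⊔ r
½<⊔ p r (inj₁ ½<p) = ℚP.<-≤-trans ½<p (ℚP.p≤p⊔q p r)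
½<⊔ p r (inj₂ ½<r) = ℚP.<-≤-trans ½<r (ℚP.p≤q⊔p p r)

½<q : ∀ G (s : Vec Bool (n G)) → T (isPartition s) → (∀ v → ½ < qv G s v) → ½ < q G
½<q G s part ½<qv = foldr-preservesᵒ ½<⊔ 0ℚ _
  (inj₂ (lose (∈-map⁺ (qPart G) (∈-filter⁺ (T? ∘ isPartition) (allVecs-complete (n G) s) part))
              ½<qPart))
  where
  ½<qPart : ½ < qPart G s
  ½<qPart = foldr-preservesᵇ {P = ½ <_} {f = _⊓_} ½<⊓ ½<1 (map⁺ (tabulate⁺ ½<qv))

Vertex□ : Graph → Graph → Set
Vertex□ G H = Fin (n G) × Fin (n H)

-- adj (G □ H) i j unfolds to adj□ G H (remQuot (n H) i) (remQuot (n H) j).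
adj□ : ∀ G H → Vertex□ G H → Vertex□ G H → Bool
adj□ G H (g₀ , h₀) (g , h) = ((g₀ == g) ∧ adj H h₀ h) ∨ ((h₀ == h) ∧ adj G g₀ g)

count□ : ∀ G H → Vertex□ G H → (Vertex□ G H → Bool) → ℕ
count□ G H p P = ∑[ g < n G ] ∑[ h < n H ] χ (adj□ G H p (g , h) ∧ P (g , h))

sameDeg□ crossDeg□ : ∀ G H → (Vertex□ G H → Bool) → Vertex□ G H → ℕ
sameDeg□  G H κ p = count□ G H p (λ x → same (κ x) (κ p))
crossDeg□ G H κ p = count□ G H p (λ x → not (same (κ x) (κ p)))

count□-swap : ∀ G H p P → count□ G H p P ≡ count□ H G (swap p) (P ∘ swap)
count□-swap G H (g₀ , h₀) P = trans (∑-comm (λ g h → χ (adj□ G H (g₀ , h₀) (g , h) ∧ P (g , h))))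
  (sum-cong-≗ λ h → sum-cong-≗ λ g →
    cong (λ b → χ (b ∧ P (g , h))) (∨-comm ((g₀ == g) ∧ adj H h₀ h) ((h₀ == h) ∧ adj G g₀ g)))

colouring□ : ∀ G H → (Vertex□ G H → Bool) → Vec Bool (n (G □ H))
colouring□ G H κ = Vec.tabulate (κ ∘ remQuot (n H))

count□-remQuot : ∀ G H κ (F : Bool → Bool) i →
  ∑[ w < n (G □ H) ] χ (adj (G □ H) i w ∧ F (same (lookup (colouring□ G H κ) w) (lookup (colouring□ G H κ) i)))
  ≡ count□ G H (remQuot (n H) i) (λ x → F (same (κ x) (κ (remQuot (n H) i))))
count□-remQuot G H κ F i = trans
  (sum-cong-≗ λ w → cong₂ (λ a b → χ (adj (G □ H) i w ∧ F (same a b)))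
    (lookup∘tabulate (κ ∘ remQuot (n H)) w) (lookup∘tabulate (κ ∘ remQuot (n H)) i))
  (∑-remQuot (n G) (n H) λ x → χ (adj□ G H (remQuot (n H) i) x ∧ F (same (κ x) (κ (remQuot (n H) i)))))

½<q□ : ∀ G H (κ : Vertex□ G H → Bool) a b → κ a ≡ true → κ b ≡ false →
       (∀ p → crossDeg□ G H κ p ≤ sameDeg□ G H κ p) → ½ < q (G □ H)
½<q□ G H κ a b κa κb balanced = ½<q (G □ H) s
  (isPartition-intro s (uncurry combine a) (uncurry combine b)
    (trans (lookup-combine a) κa) (trans (lookup-combine b) κb))
  λ i → ½<qv (G □ H) s i (subst₂ _≤_
    (sym (count□-remQuot G H κ not i)) (sym (count□-remQuot G H κ (λ x → x) i))
    (balanced (remQuot (n H) i)))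
  where
  s : Vec Bool (n (G □ H))
  s = colouring□ G H κ
  lookup-combine : ∀ x → lookup s (uncurry combine x) ≡ κ x
  lookup-combine (g , h) =
    trans (lookup∘tabulate (κ ∘ remQuot (n H)) (combine g h)) (cong κ (remQuot-combine g h))

crossDeg≤deg : ∀ G c v → crossDeg G c v ≤ deg G v
crossDeg≤deg G c v =
  ℕP.≤-trans (∑-mono-≤ (λ w → χ-∧≤ (adj G v w) _)) (ℕP.≤-reflexive (sym (deg≡∑ G v)))

crossDeg-singleton : ∀ G u v → crossDeg G (_== u) v ≤ deg G u
crossDeg-singleton G u v = by-cases (v Fin.≟ u)
  where
  open ℕP.≤-Reasoning
  by-cases : Dec (v ≡ u) → crossDeg G (_== u) v ≤ deg G u
  by-cases (yes v≡u) = subst (λ x → crossDeg G (_== u) v ≤ deg G x) v≡u (crossDeg≤deg G (_== u) v)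
  by-cases (no v≢u) = begin
    crossDeg G (_== u) v          ≡⟨ ∑-single _ u only-u ⟩
    χ (adj G v u ∧ _)             ≤⟨ χ-∧≤ (adj G v u) _ ⟩
    χ (adj G v u)                 ≡⟨ cong χ (adj-sym G v u) ⟩
    χ (adj G u v)                 ≤⟨ term≤∑ (λ w → χ (adj G u w)) v ⟩
    ∑[ w < n G ] χ (adj G u w)    ≡⟨ deg≡∑ G u ⟨
    deg G u                       ∎
    where
    only-u : ∀ w → w ≢ u → χ (adj G v w ∧ not (same (w == u) (v == u))) ≡ 0
    only-u w w≢u rewrite ==-≢ w≢u | ==-≢ v≢u = cong χ (∧-zeroʳ (adj G v w))

crossDeg□-lift≤ : ∀ G H (c : Fin (n G) → Bool) g₀ h₀ →
                  crossDeg□ G H (c ∘ proj₁) (g₀ , h₀) ≤ crossDeg G c g₀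
crossDeg□-lift≤ G H c g₀ h₀ = begin
  crossDeg□ G H (c ∘ proj₁) (g₀ , h₀)
    ≤⟨ ∑-mono-≤ (λ g → ∑-mono-≤ (across g)) ⟩
  ∑[ g < n G ] ∑[ h < n H ] χ ((h₀ == h) ∧ (adj G g₀ g ∧ not (same (c g) (c g₀))))
    ≡⟨ sum-cong-≗ (λ g → ∑-indicator h₀ (adj G g₀ g ∧ not (same (c g) (c g₀)))) ⟩
  crossDeg G c g₀ ∎
  where
  open ℕP.≤-Reasoning
  across : ∀ g h → χ (adj□ G H (g₀ , h₀) (g , h) ∧ not (same (c g) (c g₀)))
                 ≤ χ ((h₀ == h) ∧ (adj G g₀ g ∧ not (same (c g) (c g₀))))
  across g h with g₀ Fin.≟ g
  ... | yes refl rewrite same-refl (c g₀) = ℕP.≤-trans (ℕP.≤-reflexive (cong χ (∧-zeroʳ _))) z≤n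
  ... | no  _    = ℕP.≤-reflexive (cong χ (∧-assoc (h₀ == h) (adj G g₀ g) _))

deg≤sameDeg□-lift : ∀ G H (c : Fin (n G) → Bool) g₀ h₀ →
                    deg H h₀ ≤ sameDeg□ G H (c ∘ proj₁) (g₀ , h₀)
deg≤sameDeg□-lift G H c g₀ h₀ = begin
  deg H h₀                                                      ≡⟨ deg≡∑ H h₀ ⟩
  ∑[ h < n H ] χ (adj H h₀ h)                                   ≤⟨ ∑-mono-≤ along-fibre ⟩
  ∑[ h < n H ] χ (adj□ G H (g₀ , h₀) (g₀ , h) ∧ same (c g₀) (c g₀))
    ≤⟨ term≤∑ (λ g → ∑[ h < n H ] χ (adj□ G H (g₀ , h₀) (g , h) ∧ same (c g) (c g₀))) g₀ ⟩
  sameDeg□ G H (c ∘ proj₁) (g₀ , h₀)                            ∎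
  where
  open ℕP.≤-Reasoning
  along-fibre : ∀ h → χ (adj H h₀ h) ≤ χ (adj□ G H (g₀ , h₀) (g₀ , h) ∧ same (c g₀) (c g₀))
  along-fibre h rewrite ==-refl g₀ | same-refl (c g₀)
    | ∧-identityʳ (adj H h₀ h ∨ ((h₀ == h) ∧ adj G g₀ g₀)) = χ-∨≥ _ _

fibre-balanced : ∀ G H u → (∀ h → deg G u ≤ deg H h) →
                 ∀ p → crossDeg□ G H ((_== u) ∘ proj₁) p ≤ sameDeg□ G H ((_== u) ∘ proj₁) p
fibre-balanced G H u δ (g , h) = begin
  crossDeg□ G H ((_== u) ∘ proj₁) (g , h) ≤⟨ crossDeg□-lift≤ G H (_== u) g h ⟩
  crossDeg G (_== u) g                    ≤⟨ crossDeg-singleton G u g ⟩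
  deg G u                                 ≤⟨ δ h ⟩
  deg H h                                 ≤⟨ deg≤sameDeg□-lift G H (_== u) g h ⟩
  sameDeg□ G H ((_== u) ∘ proj₁) (g , h)  ∎
  where open ℕP.≤-Reasoning

proposition11 : (G H : Graph) → Connected G → Connected H →
    2 ≤ n G → 2 ≤ n H → ½ < q (G □ H)
proposition11 G H _ _ 2≤|G| 2≤|H| =
  [ fibre-over-u , fibre-over-w ]′ (ℕP.≤-total (deg G u) (deg H w))
  where
  minimum-G : ∃[ u ] (∀ g → deg G u ≤ deg G g)
  minimum-G = argmin-Fin (deg G) (Fin.fromℕ< 2≤|G|)
  minimum-H : ∃[ w ] (∀ h → deg H w ≤ deg H h)
  minimum-H = argmin-Fin (deg H) (Fin.fromℕ< 2≤|H|)
  u : Fin (n G)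
  u = proj₁ minimum-G
  w : Fin (n H)
  w = proj₁ minimum-H
  u′ : ∃[ g ] g ≢ u
  u′ = another 2≤|G| u
  w′ : ∃[ h ] h ≢ w
  w′ = another 2≤|H| w

  fibre-over-u : deg G u ≤ deg H w → ½ < q (G □ H)
  fibre-over-u δG≤δH =
    ½<q□ G H ((_== u) ∘ proj₁) (u , w) (proj₁ u′ , w) (==-refl u) (==-≢ (proj₂ u′))
      (fibre-balanced G H u λ h → ℕP.≤-trans δG≤δH (proj₂ minimum-H h))

  fibre-over-w : deg H w ≤ deg G u → ½ < q (G □ H)
  fibre-over-w δH≤δG =
    ½<q□ G H ((_== w) ∘ proj₂) (u , w) (u , proj₁ w′) (==-refl w) (==-≢ (proj₂ w′))
      λ p → subst₂ _≤_ (sym (count□-swap G H p _)) (sym (count□-swap G H p _))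
        (fibre-balanced H G w (λ g → ℕP.≤-trans δH≤δG (proj₂ minimum-G g)) (swap p))
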